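{- Let $\overrightarrow{G}$ be a DDMOG of order $n$ with DDM labeling $g$, its vertices indexed $v_1,\dots,v_n$ so that $g(v_i)=i$. Then for every integer $\ell$ with $1\le \ell\le n/2$ there exists a labeling $h$ of $\ell\overrightarrow{C_4}$ (the disjoint union of $\ell$ copies of the directed $4$-cycle, vertex-disjoint from $\overrightarrow{G}$) such that $\overrightarrow{G}\oplus_{wt_h}^0 \ell\overrightarrow{C_4}$ is a DDMOG.
   Context: An oriented graph is a digraph with no loops, no multiple arcs, and such that $(u,v)$ being an arc implies $(v,u)$ is not an arc. The directed $4$-cycle $\overrightarrow{C_4}$ has vertices $x_1,x_2,x_3,x_4$ and arcs $(x_1,x_2),(x_2,x_3),(x_3,x_4),(x_4,x_1)$. $N^+(v)$ is the set of $u$ with $(u,v)$ an arc, $N^-(v)$ the set of $u$ with $(v,u)$ an arc. For a labeling $f$, $wt_f(v)=\sum_{u\in N^+(v)} f(u) - \sum_{u \in N^-(v)} f(u)$. A DDM labeling of an oriented graph on $n$ vertices is a bijection $f:V\to\{1,\dots,n\}$ with $wt_f(v)=0$ for all $v$; a DDMOG is an oriented graph admitting one. For a labeling $h$ of $\overrightarrow{H}$ and integer $j$, $V_h^{j}(\overrightarrow{H})=\{u: wt_h(u)=j\}$. Weighted sum: with $\overrightarrow{G}$'s vertices $v_1,\dots,v_n$ indexed so $g(v_i)=i$, integer $s$, and $\overrightarrow{H}$ vertex-disjoint from $\overrightarrow{G}$ with labeling $h:V(\overrightarrow{H})\to\mathbb{Z}^+$ such that $\{|wt_h(u)|\}\subseteq\{0\}\cup\{i+s:1\le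 i\le n\}$, the graph $\overrightarrow{G}\oplus_{wt_h}^s\overrightarrow{H}$ has vertex set $V(\overrightarrow{G})\cup V(\overrightarrow{H})$ and arc set $E(\overrightarrow{G})\cup E(\overrightarrow{H})\cup\bigcup_{i=1}^n(E^i\cup E^{ -i})$, where $E^i=\{(v_i,u): u\in V_h^{ -i-s}(\overrightarrow{H})\}$ and $E^{ -i}=\{(u,v_i): u\in V_h^{i+s}(\overrightarrow{H})\}$. -}

module Defs where

open import Data.Nat as ℕ using (ℕ; zero; suc)
open import Data.Integer using (ℤ; +_; 0ℤ; _+_; _-_; -_; ∣_∣; _≟_)
open import Data.Fin as Fin using (Fin; toℕ; splitAt; remQuot)
open import Data.Bool using (Bool; true; false; if_then_else_; _∧_)
open import Data.Sum using (_⊎_; inj₁; inj₂)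
open import Data.Product using (Σ; _×_; _,_; ∃; proj₁; proj₂)
open import Relation.Binary.PropositionalEquality using (_≡_)
open import Relation.Nullary.Decidable using (⌊_⌋)
open import Function.Definitions using (Bijective)

-- A digraph on vertex set Fin n, given by its (decidable) arc relation:
-- arc u v ≡ true  means (u,v) is an arc.  No multiple arcs by construction.
Arcs : ℕ → Set
Arcs n = Fin n → Fin n → Bool

IsOriented : ∀ {n} → Arcs n → Set
IsOriented {n} A = (∀ (v : Fin n) → A v v ≡ false)
                 × (∀ (u v : Fin n) → A u v ≡ true → A v u ≡ false)

sumFin : ∀ n → (Fin n → ℤ) → ℤ
sumFin zero    f = 0ℤ
sumFin (suc n) f = f Fin.zero + sumFin n (λ i → f (Fin.suc i))

-- wt_f(v) = Σ_{u ∈ N⁺(v)} f(u) − Σ_{u ∈ N⁻(v)} f(u),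
-- where N⁺(v) = {u : (u,v) arc}, N⁻(v) = {u : (v,u) arc}
wt : ∀ {n} → Arcs n → (Fin n → ℤ) → Fin n → ℤ
wt {n} A f v = sumFin n (λ u → if A u v then f u else 0ℤ)
             - sumFin n (λ u → if A v u then f u else 0ℤ)

-- A labeling onto {1,…,n} is encoded as g : Fin n → Fin n, vertex v
-- getting the label 1 + toℕ (g v).
label : ∀ {n} → (Fin n → Fin n) → Fin n → ℤ
label g v = + suc (toℕ (g v))

IsDDMLabeling : ∀ {n} → Arcs n → (Fin n → Fin n) → Set
IsDDMLabeling A g = Bijective _≡_ _≡_ g × (∀ v → wt A (label g) v ≡ 0ℤ)

IsDDMOG : ∀ {n} → Arcs n → Set
IsDDMOG {n} A = IsOriented A × Σ (Fin n → Fin n) (λ g → IsDDMLabeling A g)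

-- successor in the directed 4-cycle x₁→x₂→x₃→x₄→x₁
next4 : Fin 4 → Fin 4
next4 Fin.zero = Fin.suc Fin.zero
next4 (Fin.suc Fin.zero) = Fin.suc (Fin.suc Fin.zero)
next4 (Fin.suc (Fin.suc Fin.zero)) = Fin.suc (Fin.suc (Fin.suc Fin.zero))
next4 (Fin.suc (Fin.suc (Fin.suc Fin.zero))) = Fin.zero

-- ℓ C⃗₄ : vertex set Fin (ℓ * 4), vertex w is position (remainder) of copy (quotient)
ℓC4 : ∀ ℓ → Arcs (ℓ ℕ.* 4)
ℓC4 ℓ u v with remQuot {ℓ} 4 u | remQuot {ℓ} 4 v
... | (cu , pu) | (cv , pv) = ⌊ cu Fin.≟ cv ⌋ ∧ ⌊ next4 pu Fin.≟ pv ⌋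

WtAdmissible : ∀ (n : ℕ) (s : ℤ) {m} → Arcs m → (Fin m → ℤ) → Set
WtAdmissible n s {m} B h =
  ∀ (u : Fin m) → (+ ∣ wt B h u ∣ ≡ 0ℤ)
                ⊎ Σ (Fin n) (λ i → + ∣ wt B h u ∣ ≡ (+ suc (toℕ i)) + s)

-- Weighted sum G ⊕^s_{wt_h} H on vertex set Fin (n + m): the first n
-- vertices are those of G, the last m those of H.  The vertex v of G is
-- v_i where i = g(v) (the DDM labeling value).
weightedSum : ∀ {n m} → Arcs n → (Fin n → Fin n) → ℤ → Arcs m → (Fin m → ℤ)
            → Arcs (n ℕ.+ m)
weightedSum {n} A g s B h x y with splitAt n x | splitAt n y
... | inj₁ a | inj₁ b = A a b
... | inj₂ a | inj₂ b = B a b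
... | inj₁ v | inj₂ u = ⌊ wt B h u ≟ - (label g v + s) ⌋
... | inj₂ u | inj₁ v = ⌊ wt B h u ≟ label g v + s ⌋

-- Give the c-th copy of C⃗₄ the labels n+4c+1, …, n+4c+4 in the order x₃, x₁, x₄, x₂.
-- Then x₂, x₃ have weight +1 and x₁, x₄ weight −1, so in the weighted sum (s = 0) every
-- vertex of ℓC⃗₄ is joined to v₁ alone, in the direction that cancels its weight.  The
-- vertex v₁ in turn receives the labels of x₂, x₃ and sends those of x₁, x₄, and in each
-- copy both pairs sum to 2n+8c+5.  Hence g on G together with the labels n+1, …, n+4ℓ
-- on ℓC⃗₄ is a DDM labeling of the weighted sum.
module Submission where

open import Defs
open import Data.Nat as ℕ using (ℕ; zero; suc; _≤_; _*_; z≤n; s≤s)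
import Data.Nat.Properties as ℕP
open import Data.Integer using (ℤ; +_; -[1+_]; 0ℤ; _+_; _-_; -_; ∣_∣; _<_; +<+; _≟_)
import Data.Integer.Properties as ℤP
open import Data.Integer.Tactic.RingSolver using (solve-∀)
open import Data.Fin as Fin using (Fin; toℕ; _↑ˡ_; _↑ʳ_; splitAt; combine; quotient; remainder)
import Data.Fin.Properties as FinP
open import Data.Fin.Patterns using (0F; 1F; 2F; 3F)
open import Data.Bool using (Bool; true; false; if_then_else_; _∧_)
open import Data.Bool.Properties using (T-∧; T-≡; ¬-not)
open import Data.Product using (Σ; _×_; _,_; proj₁; proj₂)
open import Data.Sum using (_⊎_; inj₁; inj₂)
open import Data.Sum.Function.Propositional using (_⊎-⤖_)
open import Data.Empty using (⊥-elim)
open import Function using (_∘_; _⤖_; Bijection; Equivalence; mk⤖; mk↔ₛ′)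
open import Function.Definitions using (Bijective)
open import Function.Properties.Inverse using (↔⇒⤖)
open import Function.Construct.Composition using (_⤖-∘_)
open import Function.Construct.Symmetry using (↔-sym)
open import Relation.Binary.PropositionalEquality
open import Relation.Nullary using (Dec; ¬_)
open import Relation.Nullary.Decidable using (⌊_⌋; dec-true; dec-false; toWitness; isYes≗does)

module _ {a} {A : Set a} (a? : Dec A) where

  ⌊⌋-true : A → ⌊ a? ⌋ ≡ true
  ⌊⌋-true x = trans (isYes≗does a?) (dec-true a? x)

  ⌊⌋-false : ¬ A → ⌊ a? ⌋ ≡ false
  ⌊⌋-false ¬x = trans (isYes≗does a?) (dec-false a? ¬x)

  ⌊⌋-sound : ⌊ a? ⌋ ≡ true → A
  ⌊⌋-sound eq = toWitness (Equivalence.from T-≡ eq)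

positive-≢-neg : ∀ {x} → 0ℤ < x → x ≢ - x
positive-≢-neg (+<+ (s≤s _)) ()

≟-exclusive : ∀ w {x y} → x ≢ y → ⌊ w ≟ x ⌋ ≡ true → ⌊ w ≟ y ⌋ ≡ false
≟-exclusive w x≢y w≟x = ⌊⌋-false (w ≟ _) λ w≡y → x≢y (trans (sym (⌊⌋-sound (w ≟ _) w≟x)) w≡y)

sumFin-cong : ∀ n {f f′ : Fin n → ℤ} → (∀ i → f i ≡ f′ i) → sumFin n f ≡ sumFin n f′
sumFin-cong zero    eq = refl
sumFin-cong (suc n) eq = cong₂ _+_ (eq 0F) (sumFin-cong n (eq ∘ Fin.suc))

sumFin-zero : ∀ n {f : Fin n → ℤ} → (∀ i → f i ≡ 0ℤ) → sumFin n f ≡ 0ℤ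
sumFin-zero zero    eq = refl
sumFin-zero (suc n) eq = cong₂ _+_ (eq 0F) (sumFin-zero n (eq ∘ Fin.suc))

sumFin-single : ∀ n {f : Fin n → ℤ} i₀ → (∀ i → i ≢ i₀ → f i ≡ 0ℤ) → sumFin n f ≡ f i₀
sumFin-single (suc n) {f} 0F vanish =
  trans (cong (_+_ (f 0F)) (sumFin-zero n (λ i → vanish (Fin.suc i) λ ())))
        (ℤP.+-identityʳ (f 0F))
sumFin-single (suc n) {f} (Fin.suc i₀) vanish =
  trans (cong₂ _+_ (vanish 0F λ ())
                   (sumFin-single n i₀ λ i i≢i₀ → vanish (Fin.suc i) (i≢i₀ ∘ FinP.suc-injective)))
        (ℤP.+-identityˡ (f (Fin.suc i₀)))

sumFin-+ : ∀ n m (f : Fin (n ℕ.+ m) → ℤ) →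
           sumFin (n ℕ.+ m) f ≡ sumFin n (f ∘ (_↑ˡ m)) + sumFin m (f ∘ (n ↑ʳ_))
sumFin-+ zero    m f = sym (ℤP.+-identityˡ _)
sumFin-+ (suc n) m f =
  trans (cong (_+_ (f 0F)) (sumFin-+ n m (f ∘ Fin.suc)))
        (sym (ℤP.+-assoc (f 0F) (sumFin n (f ∘ Fin.suc ∘ (_↑ˡ m))) (sumFin m (f ∘ (suc n ↑ʳ_)))))

sumFin-combine : ∀ k m (f : Fin (k * m) → ℤ) →
                 sumFin (k * m) f ≡ sumFin k (λ c → sumFin m (λ p → f (combine c p)))
sumFin-combine zero    m f = refl
sumFin-combine (suc k) m f =
  trans (sumFin-+ m (k * m) f) (cong (_+_ (sumFin m (f ∘ (_↑ˡ k * m)))) (sumFin-combine k m (f ∘ (m ↑ʳ_))))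

sumFin-single-∘ : ∀ n {g : Fin n → Fin n} → Bijective _≡_ _≡_ g →
                  (t : Fin n → ℤ) (c₀ : Fin n) → (∀ c → c ≢ c₀ → t c ≡ 0ℤ) → sumFin n (t ∘ g) ≡ t c₀
sumFin-single-∘ n {g} (injective , surjective) t c₀ vanish =
  trans (sumFin-single n a₀ λ a a≢a₀ → vanish (g a) λ ga≡c₀ → a≢a₀ (injective (trans ga≡c₀ (sym ga₀≡c₀))))
        (cong t ga₀≡c₀)
  where
  a₀ : Fin n
  a₀ = proj₁ (surjective c₀)
  ga₀≡c₀ : g a₀ ≡ c₀
  ga₀≡c₀ = proj₂ (surjective c₀) refl

sumWhere : ∀ n → (Fin n → Bool) → (Fin n → ℤ) → ℤ
sumWhere n P f = sumFin n (λ i → if P i then f i else 0ℤ)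

sumWhere-cong : ∀ n {P Q : Fin n → Bool} {f f′ : Fin n → ℤ} →
                (∀ i → P i ≡ Q i) → (∀ i → f i ≡ f′ i) → sumWhere n P f ≡ sumWhere n Q f′
sumWhere-cong n P≡Q f≡f′ = sumFin-cong n λ i → cong₂ (λ b x → if b then x else 0ℤ) (P≡Q i) (f≡f′ i)

sumWhere-unique : ∀ n {P : Fin n → Bool} (f : Fin n → ℤ) {i₀} →
                  P i₀ ≡ true → (∀ i → P i ≡ true → i ≡ i₀) → sumWhere n P f ≡ f i₀
sumWhere-unique n {P} f {i₀} Pi₀ unique =
  trans (sumFin-single n i₀ outside) (cong (λ b → if b then f i₀ else 0ℤ) Pi₀)
  where
  outside : ∀ i → i ≢ i₀ → (if P i then f i else 0ℤ) ≡ 0ℤ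
  outside i i≢i₀ with P i in Pi
  ... | true  = ⊥-elim (i≢i₀ (unique i Pi))
  ... | false = refl

data Side n m : Fin (n ℕ.+ m) → Set where
  left  : (a : Fin n) → Side n m (a ↑ˡ m)
  right : (b : Fin m) → Side n m (n ↑ʳ b)

side : ∀ n m (x : Fin (n ℕ.+ m)) → Side n m x
side n m x = subst (Side n m) (FinP.join-splitAt n m x) (fromSum (splitAt n x))
  where
  fromSum : (y : Fin n ⊎ Fin m) → Side n m (Fin.join n m y)
  fromSum (inj₁ a) = left a
  fromSum (inj₂ b) = right b

prev4 : Fin 4 → Fin 4
prev4 0F = 3F
prev4 1F = 0F
prev4 2F = 1F
prev4 3F = 2F

prev4-next4 : ∀ p → prev4 (next4 p) ≡ p
prev4-next4 0F = refl
prev4-next4 1F = refl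
prev4-next4 2F = refl
prev4-next4 3F = refl

next4-prev4 : ∀ p → next4 (prev4 p) ≡ p
next4-prev4 0F = refl
next4-prev4 1F = refl
next4-prev4 2F = refl
next4-prev4 3F = refl

next4-irreflexive : ∀ p → next4 p ≢ p
next4-irreflexive 0F ()
next4-irreflexive 1F ()
next4-irreflexive 2F ()
next4-irreflexive 3F ()

next4²-irreflexive : ∀ p → next4 (next4 p) ≢ p
next4²-irreflexive 0F ()
next4²-irreflexive 1F ()
next4²-irreflexive 2F ()
next4²-irreflexive 3F ()

-- combine c p is the vertex x_{p+1} of the c-th copy of C⃗₄ in ℓC4 ℓ.
data Coordinates ℓ : Fin (ℓ * 4) → Set where
  at : (c : Fin ℓ) (p : Fin 4) → Coordinates ℓ (combine c p)

coordinates : ∀ ℓ (u : Fin (ℓ * 4)) → Coordinates ℓ u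
coordinates ℓ u = subst (Coordinates ℓ) (FinP.combine-remQuot {ℓ} 4 u) (at _ _)

ℓC4-combine : ∀ ℓ (c d : Fin ℓ) p q →
              ℓC4 ℓ (combine c p) (combine d q) ≡ ⌊ c Fin.≟ d ⌋ ∧ ⌊ next4 p Fin.≟ q ⌋
ℓC4-combine ℓ c d p q =
  cong₂ (λ x y → ⌊ proj₁ x Fin.≟ proj₁ y ⌋ ∧ ⌊ next4 (proj₂ x) Fin.≟ proj₂ y ⌋)
        (FinP.remQuot-combine c p) (FinP.remQuot-combine d q)

ℓC4-arc : ∀ ℓ (c : Fin ℓ) {p q} → next4 p ≡ q → ℓC4 ℓ (combine c p) (combine c q) ≡ true
ℓC4-arc ℓ c {p} {q} next4p≡q =
  trans (ℓC4-combine ℓ c c p q) (cong₂ _∧_ (⌊⌋-true (c Fin.≟ c) refl) (⌊⌋-true (next4 p Fin.≟ q) next4p≡q))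

ℓC4-arc⁻¹ : ∀ ℓ (c d : Fin ℓ) p q → ℓC4 ℓ (combine c p) (combine d q) ≡ true → c ≡ d × next4 p ≡ q
ℓC4-arc⁻¹ ℓ c d p q arc =
  let c≟d , p≟q = Equivalence.to (T-∧ {⌊ c Fin.≟ d ⌋})
                    (Equivalence.from T-≡ (trans (sym (ℓC4-combine ℓ c d p q)) arc))
  in toWitness c≟d , toWitness p≟q

ℓC4-in : ∀ ℓ (c : Fin ℓ) p u → ℓC4 ℓ u (combine c p) ≡ true → u ≡ combine c (prev4 p)
ℓC4-in ℓ c p u arc with coordinates ℓ u
... | at d r with ℓC4-arc⁻¹ ℓ d c r p arc
... | refl , refl = cong (combine d) (sym (prev4-next4 r))

ℓC4-out : ∀ ℓ (c : Fin ℓ) p u → ℓC4 ℓ (combine c p) u ≡ true → u ≡ combine c (next4 p)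
ℓC4-out ℓ c p u arc with coordinates ℓ u
... | at d r with ℓC4-arc⁻¹ ℓ c d p r arc
... | refl , refl = refl

ℓC4-isOriented : ∀ ℓ → IsOriented (ℓC4 ℓ)
ℓC4-isOriented ℓ = loopless , antisymmetric
  where
  loopless : ∀ v → ℓC4 ℓ v v ≡ false
  loopless v with coordinates ℓ v
  ... | at c p = ¬-not (next4-irreflexive p ∘ proj₂ ∘ ℓC4-arc⁻¹ ℓ c c p p)

  antisymmetric : ∀ u v → ℓC4 ℓ u v ≡ true → ℓC4 ℓ v u ≡ false
  antisymmetric u v uv with coordinates ℓ u | coordinates ℓ v
  ... | at c p | at d q = ¬-not λ vu →
    next4²-irreflexive p (trans (cong next4 (proj₂ (ℓC4-arc⁻¹ ℓ c d p q uv))) (proj₂ (ℓC4-arc⁻¹ ℓ d c q p vu)))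

wt-ℓC4 : ∀ ℓ (f : Fin (ℓ * 4) → ℤ) c p →
         wt (ℓC4 ℓ) f (combine c p) ≡ f (combine c (prev4 p)) - f (combine c (next4 p))
wt-ℓC4 ℓ f c p = cong₂ _-_
  (sumWhere-unique (ℓ * 4) f (ℓC4-arc ℓ c (next4-prev4 p)) (ℓC4-in ℓ c p))
  (sumWhere-unique (ℓ * 4) f (ℓC4-arc ℓ c refl) (ℓC4-out ℓ c p))

-- The label of x_{p+1} exceeds the smallest label of its copy by rank4 p.
rank4 : Fin 4 → Fin 4
rank4 0F = 1F
rank4 1F = 3F
rank4 2F = 0F
rank4 3F = 2F

unrank4 : Fin 4 → Fin 4
unrank4 0F = 2F
unrank4 1F = 0F
unrank4 2F = 3F
unrank4 3F = 1F

rank4-unrank4 : ∀ p → rank4 (unrank4 p) ≡ p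
rank4-unrank4 0F = refl
rank4-unrank4 1F = refl
rank4-unrank4 2F = refl
rank4-unrank4 3F = refl

unrank4-rank4 : ∀ p → unrank4 (rank4 p) ≡ p
unrank4-rank4 0F = refl
unrank4-rank4 1F = refl
unrank4-rank4 2F = refl
unrank4-rank4 3F = refl

c4Weight : Fin 4 → ℤ
c4Weight 0F = -[1+ 0 ]
c4Weight 1F = + 1
c4Weight 2F = + 1
c4Weight 3F = -[1+ 0 ]

rank4-prev4-next4 : ∀ p → + toℕ (rank4 (prev4 p)) - + toℕ (rank4 (next4 p)) ≡ c4Weight p
rank4-prev4-next4 0F = refl
rank4-prev4-next4 1F = refl
rank4-prev4-next4 2F = refl
rank4-prev4-next4 3F = refl

∣c4Weight∣ : ∀ p → ∣ c4Weight p ∣ ≡ 1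
∣c4Weight∣ 0F = refl
∣c4Weight∣ 1F = refl
∣c4Weight∣ 2F = refl
∣c4Weight∣ 3F = refl

withinCopies : ∀ ℓ → (Fin 4 → Fin 4) → Fin (ℓ * 4) → Fin (ℓ * 4)
withinCopies ℓ φ u = combine (quotient {ℓ} 4 u) (φ (remainder {ℓ} 4 u))

withinCopies-combine : ∀ {ℓ} φ (c : Fin ℓ) p → withinCopies ℓ φ (combine c p) ≡ combine c (φ p)
withinCopies-combine φ c p = cong (λ x → combine (proj₁ x) (φ (proj₂ x))) (FinP.remQuot-combine c p)

withinCopies-inverse : ∀ ℓ (φ ψ : Fin 4 → Fin 4) → (∀ p → φ (ψ p) ≡ p) →
                       ∀ u → withinCopies ℓ φ (withinCopies ℓ ψ u) ≡ u
withinCopies-inverse ℓ φ ψ φψ u with coordinates ℓ u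
... | at c p = begin
  withinCopies ℓ φ (withinCopies ℓ ψ (combine c p)) ≡⟨ cong (withinCopies ℓ φ) (withinCopies-combine ψ c p) ⟩
  withinCopies ℓ φ (combine c (ψ p))                 ≡⟨ withinCopies-combine φ c (ψ p) ⟩
  combine c (φ (ψ p))                                ≡⟨ cong (combine c) (φψ p) ⟩
  combine c p                                        ∎
  where open ≡-Reasoning

rankC4 : ∀ ℓ → Fin (ℓ * 4) ⤖ Fin (ℓ * 4)
rankC4 ℓ = ↔⇒⤖ (mk↔ₛ′ (withinCopies ℓ rank4) (withinCopies ℓ unrank4)
                        (withinCopies-inverse ℓ rank4 unrank4 rank4-unrank4)
                        (withinCopies-inverse ℓ unrank4 rank4 unrank4-rank4))

c4Labeling : ℕ → ∀ ℓ → Fin (ℓ * 4) → ℤ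
c4Labeling n ℓ u = + suc (n ℕ.+ toℕ (Bijection.to (rankC4 ℓ) u))

copyBase : ℕ → ∀ {ℓ} → Fin ℓ → ℤ
copyBase n c = + suc (n ℕ.+ 4 * toℕ c)

c4Labeling-combine : ∀ n ℓ (c : Fin ℓ) p → c4Labeling n ℓ (combine c p) ≡ copyBase n c + + toℕ (rank4 p)
c4Labeling-combine n ℓ c p = begin
  + suc (n ℕ.+ toℕ (withinCopies ℓ rank4 (combine c p)))
    ≡⟨ cong (λ u → + suc (n ℕ.+ toℕ u)) (withinCopies-combine rank4 c p) ⟩
  + suc (n ℕ.+ toℕ (combine c (rank4 p)))
    ≡⟨ cong (λ k → + suc (n ℕ.+ k)) (FinP.toℕ-combine c (rank4 p)) ⟩
  + suc (n ℕ.+ (4 * toℕ c ℕ.+ toℕ (rank4 p)))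
    ≡⟨ cong (+_ ∘ suc) (sym (ℕP.+-assoc n (4 * toℕ c) (toℕ (rank4 p)))) ⟩
  + (suc (n ℕ.+ 4 * toℕ c) ℕ.+ toℕ (rank4 p))
    ≡⟨ ℤP.pos-+ (suc (n ℕ.+ 4 * toℕ c)) (toℕ (rank4 p)) ⟩
  copyBase n c + + toℕ (rank4 p) ∎
  where open ≡-Reasoning

wt-c4Labeling : ∀ n ℓ (c : Fin ℓ) p → wt (ℓC4 ℓ) (c4Labeling n ℓ) (combine c p) ≡ c4Weight p
wt-c4Labeling n ℓ c p = begin
  wt (ℓC4 ℓ) h (combine c p)                           ≡⟨ wt-ℓC4 ℓ h c p ⟩
  h (combine c (prev4 p)) - h (combine c (next4 p))    ≡⟨ cong₂ _-_ (c4Labeling-combine n ℓ c (prev4 p))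
                                                                    (c4Labeling-combine n ℓ c (next4 p)) ⟩
  (B + x) - (B + y)                                    ≡⟨ cancel B x y ⟩
  x - y                                                ≡⟨ rank4-prev4-next4 p ⟩
  c4Weight p                                           ∎
  where
  open ≡-Reasoning
  h : Fin (ℓ * 4) → ℤ
  h = c4Labeling n ℓ
  B x y : ℤ
  B = copyBase n c
  x = + toℕ (rank4 (prev4 p))
  y = + toℕ (rank4 (next4 p))
  cancel : ∀ B x y → (B + x) - (B + y) ≡ x - y
  cancel = solve-∀

∣wt-c4Labeling∣ : ∀ n ℓ u → ∣ wt (ℓC4 ℓ) (c4Labeling n ℓ) u ∣ ≡ 1
∣wt-c4Labeling∣ n ℓ u with coordinates ℓ u
... | at c p = trans (cong ∣_∣ (wt-c4Labeling n ℓ c p)) (∣c4Weight∣ p)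

copy-balanced : ∀ (B : ℤ) k →
  sumWhere 4 (λ p → ⌊ c4Weight p ≟ + suc k ⌋) (λ p → B + + toℕ (rank4 p))
  ≡ sumWhere 4 (λ p → ⌊ c4Weight p ≟ -[1+ k ] ⌋) (λ p → B + + toℕ (rank4 p))
copy-balanced B zero    = balance B
  where
  balance : ∀ B → 0ℤ + ((B + + 3) + ((B + + 0) + 0ℤ)) ≡ (B + + 1) + (0ℤ + (0ℤ + ((B + + 2) + 0ℤ)))
  balance = solve-∀
copy-balanced B (suc k) = refl

c4Labeling-balanced : ∀ n ℓ k →
  sumWhere (ℓ * 4) (λ u → ⌊ wt (ℓC4 ℓ) (c4Labeling n ℓ) u ≟ + suc k ⌋) (c4Labeling n ℓ)
  ≡ sumWhere (ℓ * 4) (λ u → ⌊ wt (ℓC4 ℓ) (c4Labeling n ℓ) u ≟ -[1+ k ] ⌋) (c4Labeling n ℓ)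
c4Labeling-balanced n ℓ k =
  trans (byCopies (+ suc k))
        (trans (sumFin-cong ℓ λ c → copy-balanced (copyBase n c) k) (sym (byCopies -[1+ k ])))
  where
  h : Fin (ℓ * 4) → ℤ
  h = c4Labeling n ℓ
  byCopies : ∀ x → sumWhere (ℓ * 4) (λ u → ⌊ wt (ℓC4 ℓ) h u ≟ x ⌋) h
                   ≡ sumFin ℓ (λ c → sumWhere 4 (λ p → ⌊ c4Weight p ≟ x ⌋) (λ p → copyBase n c + + toℕ (rank4 p)))
  byCopies x = trans (sumFin-combine ℓ 4 _) (sumFin-cong ℓ λ c →
    sumWhere-cong 4 (λ p → cong (λ w → ⌊ w ≟ x ⌋) (wt-c4Labeling n ℓ c p)) (c4Labeling-combine n ℓ c))

module WeightedSum {n m} (A : Arcs n) (g : Fin n → Fin n) (s : ℤ) (B : Arcs m) (h : Fin m → ℤ) where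

  W : Arcs (n ℕ.+ m)
  W = weightedSum A g s B h

  arc-↑ˡ-↑ˡ : ∀ a a′ → W (a ↑ˡ m) (a′ ↑ˡ m) ≡ A a a′
  arc-↑ˡ-↑ˡ a a′ rewrite FinP.splitAt-↑ˡ n a m | FinP.splitAt-↑ˡ n a′ m = refl

  arc-↑ʳ-↑ʳ : ∀ b b′ → W (n ↑ʳ b) (n ↑ʳ b′) ≡ B b b′
  arc-↑ʳ-↑ʳ b b′ rewrite FinP.splitAt-↑ʳ n m b | FinP.splitAt-↑ʳ n m b′ = refl

  arc-↑ˡ-↑ʳ : ∀ a b → W (a ↑ˡ m) (n ↑ʳ b) ≡ ⌊ wt B h b ≟ - (label g a + s) ⌋
  arc-↑ˡ-↑ʳ a b rewrite FinP.splitAt-↑ˡ n a m | FinP.splitAt-↑ʳ n m b = refl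

  arc-↑ʳ-↑ˡ : ∀ b a → W (n ↑ʳ b) (a ↑ˡ m) ≡ ⌊ wt B h b ≟ label g a + s ⌋
  arc-↑ʳ-↑ˡ b a rewrite FinP.splitAt-↑ˡ n a m | FinP.splitAt-↑ʳ n m b = refl

  isOriented : IsOriented A → IsOriented B → (∀ a → 0ℤ < label g a + s) → IsOriented W
  isOriented (A-loopless , A-antisym) (B-loopless , B-antisym) positive = loopless , antisymmetric
    where
    loopless : ∀ x → W x x ≡ false
    loopless x with side n m x
    ... | left a  = trans (arc-↑ˡ-↑ˡ a a) (A-loopless a)
    ... | right b = trans (arc-↑ʳ-↑ʳ b b) (B-loopless b)

    antisymmetric : ∀ x y → W x y ≡ true → W y x ≡ false
    antisymmetric x y xy with side n m x | side n m y
    ... | left a  | left a′  = trans (arc-↑ˡ-↑ˡ a′ a) (A-antisym a a′ (trans (sym (arc-↑ˡ-↑ˡ a a′)) xy))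
    ... | right b | right b′ = trans (arc-↑ʳ-↑ʳ b′ b) (B-antisym b b′ (trans (sym (arc-↑ʳ-↑ʳ b b′)) xy))
    ... | left a  | right b  = trans (arc-↑ʳ-↑ˡ b a)
      (≟-exclusive (wt B h b) (positive-≢-neg (positive a) ∘ sym) (trans (sym (arc-↑ˡ-↑ʳ a b)) xy))
    ... | right b | left a   = trans (arc-↑ˡ-↑ʳ a b)
      (≟-exclusive (wt B h b) (positive-≢-neg (positive a)) (trans (sym (arc-↑ʳ-↑ˡ b a)) xy))

  module _ (f : Fin (n ℕ.+ m) → ℤ) (f-↑ˡ : ∀ a → f (a ↑ˡ m) ≡ label g a) (f-↑ʳ : ∀ b → f (n ↑ʳ b) ≡ h b) where

    sumWhere-sides : ∀ {P : Fin (n ℕ.+ m) → Bool} {Pˡ Pʳ} →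
                     (∀ a → P (a ↑ˡ m) ≡ Pˡ a) → (∀ b → P (n ↑ʳ b) ≡ Pʳ b) →
                     sumWhere (n ℕ.+ m) P f ≡ sumWhere n Pˡ (label g) + sumWhere m Pʳ h
    sumWhere-sides Pˡ≡ Pʳ≡ =
      trans (sumFin-+ n m _) (cong₂ _+_ (sumWhere-cong n Pˡ≡ f-↑ˡ) (sumWhere-cong m Pʳ≡ f-↑ʳ))

    interchange : ∀ p q r t → (p + q) - (r + t) ≡ (p - r) + (q - t)
    interchange = solve-∀

    wt-↑ˡ : ∀ a → wt W f (a ↑ˡ m)
                  ≡ wt A (label g) a + (sumWhere m (λ b → ⌊ wt B h b ≟ label g a + s ⌋) h
                                         - sumWhere m (λ b → ⌊ wt B h b ≟ - (label g a + s) ⌋) h)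
    wt-↑ˡ a = trans (cong₂ _-_ (sumWhere-sides (λ a′ → arc-↑ˡ-↑ˡ a′ a) (λ b → arc-↑ʳ-↑ˡ b a))
                               (sumWhere-sides (arc-↑ˡ-↑ˡ a) (arc-↑ˡ-↑ʳ a)))
                    (interchange (sumWhere n (λ a′ → A a′ a) (label g)) (sumWhere m into h)
                                 (sumWhere n (A a) (label g)) (sumWhere m outOf h))
      where
      into outOf : Fin m → Bool
      into  b = ⌊ wt B h b ≟ label g a + s ⌋
      outOf b = ⌊ wt B h b ≟ - (label g a + s) ⌋

    wt-↑ʳ : ∀ b → wt W f (n ↑ʳ b)
                  ≡ (sumWhere n (λ a → ⌊ wt B h b ≟ - (label g a + s) ⌋) (label g)
                     - sumWhere n (λ a → ⌊ wt B h b ≟ label g a + s ⌋) (label g)) + wt B h b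
    wt-↑ʳ b = trans (cong₂ _-_ (sumWhere-sides (λ a → arc-↑ˡ-↑ʳ a b) (λ b′ → arc-↑ʳ-↑ʳ b′ b))
                               (sumWhere-sides (arc-↑ʳ-↑ˡ b) (arc-↑ʳ-↑ʳ b)))
                    (interchange (sumWhere n into (label g)) (sumWhere m (λ b′ → B b′ b) h)
                                 (sumWhere n outOf (label g)) (sumWhere m (B b) h))
      where
      into outOf : Fin n → Bool
      into  a = ⌊ wt B h b ≟ - (label g a + s) ⌋
      outOf a = ⌊ wt B h b ≟ label g a + s ⌋

module Construction {n′} (A : Arcs (suc n′)) (g : Fin (suc n′) → Fin (suc n′))
                    (g-ddm : IsDDMLabeling A g) (ℓ : ℕ) where

  n : ℕ
  n = suc n′

  h : Fin (ℓ * 4) → ℤ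
  h = c4Labeling n ℓ

  open WeightedSum A g 0ℤ (ℓC4 ℓ) h

  F : Fin (n ℕ.+ ℓ * 4) ⤖ Fin (n ℕ.+ ℓ * 4)
  F = ↔⇒⤖ (↔-sym FinP.+↔⊎) ⤖-∘ ((mk⤖ (proj₁ g-ddm) ⊎-⤖ rankC4 ℓ) ⤖-∘ ↔⇒⤖ FinP.+↔⊎)

  labelF-↑ˡ : ∀ a → label (Bijection.to F) (a ↑ˡ ℓ * 4) ≡ label g a
  labelF-↑ˡ a rewrite FinP.splitAt-↑ˡ n a (ℓ * 4) = cong (+_ ∘ suc) (FinP.toℕ-↑ˡ (g a) (ℓ * 4))

  labelF-↑ʳ : ∀ b → label (Bijection.to F) (n ↑ʳ b) ≡ h b
  labelF-↑ʳ b rewrite FinP.splitAt-↑ʳ n (ℓ * 4) b = cong (+_ ∘ suc) (FinP.toℕ-↑ʳ n (Bijection.to (rankC4 ℓ) b))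

  sumWhere-label : (Q : ℤ → Bool) → (∀ k → Q (+ suc (suc k)) ≡ false) →
                   sumWhere n (λ a → Q (label g a)) (label g) ≡ (if Q (+ 1) then + 1 else 0ℤ)
  sumWhere-label Q Q-vanish =
    sumFin-single-∘ n (proj₁ g-ddm) (λ k → if Q (+ suc (toℕ k)) then + suc (toℕ k) else 0ℤ) 0F vanish
    where
    vanish : ∀ k → k ≢ 0F → (if Q (+ suc (toℕ k)) then + suc (toℕ k) else 0ℤ) ≡ 0ℤ
    vanish 0F          0≢0 = ⊥-elim (0≢0 refl)
    vanish (Fin.suc k) _   = cong (λ b → if b then + suc (toℕ (Fin.suc k)) else 0ℤ) (Q-vanish (toℕ k))

  flow-from-G : ∀ w → ∣ w ∣ ≡ 1 →
    sumWhere n (λ a → ⌊ w ≟ - (label g a + 0ℤ) ⌋) (label g) - sumWhere n (λ a → ⌊ w ≟ label g a + 0ℤ ⌋) (label g)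
    ≡ - w
  flow-from-G (+ 1)    refl = cong₂ _-_ (sumWhere-label (λ x → ⌊ + 1 ≟ - (x + 0ℤ) ⌋) λ _ → refl)
                                        (sumWhere-label (λ x → ⌊ + 1 ≟ x + 0ℤ ⌋) λ _ → refl)
  flow-from-G -[1+ 0 ] refl = cong₂ _-_ (sumWhere-label (λ x → ⌊ -[1+ 0 ] ≟ - (x + 0ℤ) ⌋) λ _ → refl)
                                        (sumWhere-label (λ x → ⌊ -[1+ 0 ] ≟ x + 0ℤ ⌋) λ _ → refl)

  wt-labelF : ∀ x → wt W (label (Bijection.to F)) x ≡ 0ℤ
  wt-labelF x with side n (ℓ * 4) x
  -- label g a + 0ℤ computes to + suc (toℕ (g a) ℕ.+ 0).
  ... | left a = trans (wt-↑ˡ (label (Bijection.to F)) labelF-↑ˡ labelF-↑ʳ a)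
                       (cong₂ _+_ (proj₂ g-ddm a) (ℤP.i≡j⇒i-j≡0 (c4Labeling-balanced n ℓ (toℕ (g a) ℕ.+ 0))))
  ... | right b = trans (wt-↑ʳ (label (Bijection.to F)) labelF-↑ˡ labelF-↑ʳ b)
                        (trans (cong (_+ w) (flow-from-G w (∣wt-c4Labeling∣ n ℓ b))) (ℤP.+-inverseˡ w))
    where
    w : ℤ
    w = wt (ℓC4 ℓ) h b

  isDDMOG : IsOriented A → IsDDMOG W
  isDDMOG A-oriented =
    isOriented A-oriented (ℓC4-isOriented ℓ) (λ _ → +<+ (s≤s z≤n)) ,
    Bijection.to F , Bijection.bijective F , wt-labelF

  admissible : WtAdmissible n 0ℤ (ℓC4 ℓ) h
  admissible u = inj₂ (0F , cong +_ (∣wt-c4Labeling∣ n ℓ u))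

corollary2 : (n : ℕ) (A : Arcs n) (g : Fin n → Fin n)
  → IsOriented A → IsDDMLabeling A g
  → (ℓ : ℕ) → 1 ≤ ℓ → 2 * ℓ ≤ n
  → Σ (Fin (ℓ * 4) → ℤ) (λ h →
       (∀ u → 0ℤ < h u)
       × WtAdmissible n 0ℤ (ℓC4 ℓ) h
       × IsDDMOG (weightedSum A g 0ℤ (ℓC4 ℓ) h))
-- The bound 2ℓ ≤ n is needed only to exclude n = 0: the construction uses the vertex v₁.
corollary2 zero     A g _          _     ℓ (s≤s z≤n) ()
corollary2 (suc n′) A g A-oriented g-ddm ℓ _ _ =
  h , (λ _ → +<+ (s≤s z≤n)) , admissible , isDDMOG A-oriented
  where open Construction A g g-ddm ℓ
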